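{- Let $T$ be a tree that has at least two regular cores, and let $L\subseteq V$. Suppose that for every regular core $v$ of $T$, the set of vertices of $L$ lying on the g-legs of $v$ is a local set of $v$. Then for every regular core $v$ and every pair of distinct vertices $x,y\notin L$ in the subtree consisting of $v$ and its g-legs, there are at least two vertices of $L$ that separate $x$ and $y$.
   Context: Let $T=(V,E)$ be a finite tree and $d(x,y)$ the number of edges on the path between $x$ and $y$. A vertex $\tau$ separates $u$ and $w$ if $d(u,\tau)\neq d(w,\tau)$. A core is a vertex of degree at least $3$. For a vertex $v$, the subtrees of the neighbors of $v$ are the connected components of $T-v$. A (standard) leg of a core $v$ is a subtree of a neighbor of $v$ containing no core (a path attached to $v$); it is short if it has one vertex and long otherwise. For a leg $\ell$ of $v$, $\ell^i$ denotes the vertex of $\ell$ at distance $i$ from $v$ (its position is $i$). A small core is a core of degree exactly $3$ with at least two legs, at least one of which is short; other cores are regular. A modified leg of a core $v$ is a subtree of a neighbor of $v$ containing exactly one core, which is a small core $w$; the position of a vertex on it is its distance from $v$; if $w$ has position $i$, the two vertices of position $i+1$ are $\ell^a,\ell^b$, where $\ell^b$ is the vertex of a short leg of $w$ (chosen arbitrarily if both legs of $w$ inside $\ell$ are short). A g-leg of $v$ is a standard leg or a modified leg of $v$. Solution types. For a set $S$ and a standard leg $\ell$, $S\cap\ell$ is of type $(s,0)$ if empty; $(s,1)$ if it is a single vertex of position at least $2$; $(s,2)$ if it has at least two vertices; $(s,3)$ if it equals $\{\ell^1\}$. For a modified leg $\ell$ whose small core has position $i$: type $(m,1)$ if $S\cap\ell$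 equals $\{\ell^a\}$ or $\{\ell^b\}$; type $(m,2)$ if it contains neither $\ell^a$ nor $\ell^b$ and contains at least two vertices of position at least $i+2$; type $(m,3)$ if it has at least two vertices, at least one of which is $\ell^a$ or $\ell^b$. A local set of a core $v$ is a set $S$ of vertices of the g-legs of $v$ (so $v\notin S$) such that: (1) at most one standard leg has type $(s,0)$ and all other standard legs have type $(s,1)$, $(s,2)$ or $(s,3)$; (2) every modified leg has type $(m,1)$, $(m,2)$ or $(m,3)$; (3) if some standard leg has type $(s,0)$ then no modified leg has type $(m,1)$; (4) if some long leg $\ell$ has type $(s,0)$ then every long leg other than $\ell$ has type $(s,2)$; (5) if some short leg has type $(s,0)$ then every long leg has type $(s,2)$ or $(s,3)$. -}

module Defs where

open import Data.Nat using (ℕ; zero; suc; _≤_)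
open import Data.Fin using (Fin)
open import Data.Bool using (Bool; true; false)
open import Data.List using (List; []; _∷_; length; filterᵇ)
open import Data.List.Membership.Propositional using (_∈_; _∉_)
open import Data.List.Relation.Unary.Unique.Propositional using (Unique)
open import Data.Fin.Properties using ()
open import Data.List using (allFin)
open import Data.Product using (Σ; ∃; ∃-syntax; _×_; _,_)
open import Data.Sum using (_⊎_)
open import Relation.Binary.PropositionalEquality using (_≡_; _≢_)
open import Relation.Nullary using (¬_)

module _ {n : ℕ} (E : Fin n → Fin n → Bool) where

  Adj : Fin n → Fin n → Set
  Adj x y = E x y ≡ true

  data IsWalk : Fin n → Fin n → List (Fin n) → Set where
    single : ∀ {x} → IsWalk x x (x ∷ [])
    cons   : ∀ {x y z p} → Adj x y → IsWalk y z p → IsWalk x z (x ∷ p)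

  IsPath : Fin n → Fin n → List (Fin n) → Set
  IsPath x y p = IsWalk x y p × Unique p

  IsTree : Set
  IsTree = (∀ x y → E x y ≡ E y x)
         × (∀ x → E x x ≡ false)
         × (∀ x y → ∃[ p ] IsPath x y p)
         × (∀ x y p q → IsPath x y p → IsPath x y q → p ≡ q)

  -- d(x,y) = k : the (unique) path between x and y has k edges
  Dist : Fin n → Fin n → ℕ → Set
  Dist x y k = ∃[ p ] (IsPath x y p × length p ≡ suc k)

  Separates : Fin n → Fin n → Fin n → Set
  Separates τ u w = ∃[ k₁ ] ∃[ k₂ ] (Dist u τ k₁ × Dist w τ k₂ × k₁ ≢ k₂)

  deg : Fin n → ℕ
  deg v = length (filterᵇ (E v) (allFin n))

  Core : Fin n → Set
  Core v = 3 ≤ deg v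

  -- x lies in the subtree of the neighbour a of v, i.e. in the connected
  -- component of T - v containing a (requires a to be a neighbour of v).
  InSub : Fin n → Fin n → Fin n → Set
  InSub v a x = Adj v a × ∃[ p ] (IsWalk a x p × v ∉ p)

  Leg : Fin n → Fin n → Set
  Leg v a = Adj v a × (∀ x → InSub v a x → ¬ Core x)

  ShortLeg : Fin n → Fin n → Set
  ShortLeg v a = Leg v a × (∀ x → InSub v a x → x ≡ a)

  LongLeg : Fin n → Fin n → Set
  LongLeg v a = Leg v a × ¬ (∀ x → InSub v a x → x ≡ a)

  SmallCore : Fin n → Set
  SmallCore w = deg w ≡ 3 × ∃[ a ] ∃[ b ] (a ≢ b × Leg w a × Leg w b × ShortLeg w a)

  RegularCore : Fin n → Set
  RegularCore v = Core v × ¬ SmallCore v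

  ModLeg : Fin n → Fin n → Fin n → Set
  ModLeg v a w = Adj v a × InSub v a w × SmallCore w
               × (∀ x → InSub v a x → Core x → x ≡ w)

  OnGLeg : Fin n → Fin n → Set
  OnGLeg v x = ∃[ a ] ((Leg v a ⊎ ∃[ w ] ModLeg v a w) × InSub v a x)

  module _ (S : Fin n → Set) (v a : Fin n) where

    TypeS0 TypeS1 TypeS2 TypeS3 : Set
    TypeS0 = ∀ x → InSub v a x → ¬ S x
    TypeS1 = ∃[ x ] (InSub v a x × S x × (∃[ k ] (Dist v x k × 2 ≤ k))
                     × (∀ y → InSub v a y → S y → y ≡ x))
    TypeS2 = ∃[ x ] ∃[ y ] (x ≢ y × InSub v a x × S x × InSub v a y × S y)
    TypeS3 = S a × (∀ y → InSub v a y → S y → y ≡ a)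

    -- for a modified leg with small core w: ℓ^a, ℓ^b are the vertices of ℓ
    -- at position i+1, where i is the position of w
    module _ (w : Fin n) where

      Special : Fin n → Set
      Special x = InSub v a x × ∃[ i ] (Dist v w i × Dist v x (suc i))

      FarPos : Fin n → Set
      FarPos x = ∃[ i ] ∃[ j ] (Dist v w i × Dist v x j × suc (suc i) ≤ j)

      TypeM1 TypeM2 TypeM3 : Set
      TypeM1 = ∃[ x ] (Special x × S x × (∀ y → InSub v a y → S y → y ≡ x))
      TypeM2 = (∀ x → Special x → ¬ S x)
             × ∃[ x ] ∃[ y ] (x ≢ y × InSub v a x × S x × FarPos x
                                    × InSub v a y × S y × FarPos y)
      TypeM3 = ∃[ x ] ∃[ y ] (x ≢ y × InSub v a x × S x × InSub v a y × S y)
             × ∃[ z ] (Special z × S z)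

  LocalSet : Fin n → (Fin n → Set) → Set
  LocalSet v S =
      (∀ x → S x → OnGLeg v x)
    × (∀ a b → Leg v a → Leg v b → TypeS0 S v a → TypeS0 S v b → a ≡ b)
    × (∀ a → Leg v a → TypeS0 S v a ⊎ TypeS1 S v a ⊎ TypeS2 S v a ⊎ TypeS3 S v a)
    × (∀ a w → ModLeg v a w → TypeM1 S v a w ⊎ TypeM2 S v a w ⊎ TypeM3 S v a w)
    × (∀ a → Leg v a → TypeS0 S v a → ∀ b w → ModLeg v b w → ¬ TypeM1 S v b w)
    × (∀ a → LongLeg v a → TypeS0 S v a → ∀ b → LongLeg v b → b ≢ a → TypeS2 S v b)
    × (∀ a → ShortLeg v a → TypeS0 S v a → ∀ b → LongLeg v b → TypeS2 S v b ⊎ TypeS3 S v b)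

module Submission where

-- Proof.  (i) If d(x,v) ≠ d(y,v), every τ outside the g-legs of v satisfies
-- d(x,τ) = d(x,v) + d(v,τ) and likewise for y, so τ separates x and y.  Two such
-- τ ∈ L exist: walking from a second regular core away from v one reaches a
-- regular core u that is extremal (no branch of u avoiding v contains a regular
-- core).  Those branches are g-legs of u, there are at least two of them, and the
-- local-set axioms at u place two vertices of L in them.
-- (ii) If d(x,v) = d(y,v) and x, y lie on different g-legs, every vertex of these
-- two legs separates x and y, and the local-set axioms at v (using x, y ∉ L) put
-- two vertices of L on them.  (iii) If x, y lie on the same g-leg, it is a
-- modified leg and {x, y} = {ℓ^a, ℓ^b}; these are not in L, so the leg has type
-- (m,2), and its two far vertices lie on the long leg of the small core and
-- separate x and y.

open import Defs
open import Data.Nat using (ℕ; zero; suc; _+_; _∸_; _≤_; _<_; z≤n; s≤s; s≤s⁻¹; _≤?_)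
  renaming (_≟_ to _≟ℕ_)
open import Data.Nat.Properties
  using (≤-refl; ≤-trans; ≤-antisym; ≤-reflexive; <-irrefl; <⇒≱; n≤1+n; m≤m+n; m<m+n;
         +-suc; +-comm; +-mono-≤; +-monoʳ-≤; +-cancelˡ-≡; +-cancelʳ-≡; +-identityʳ;
         suc-injective; m≢1+m+n; <⇒≢; ≤∧≢⇒<; 0≢1+n; module ≤-Reasoning)
open import Data.Fin using (Fin; _≟_)
open import Data.Fin.Properties using () renaming (all? to all-Fin?; any? to any-Fin?)
open import Data.Bool using (Bool; true)
import Data.Bool as Bool
open import Data.List using (List; []; _∷_; length; _++_; drop; filterᵇ; allFin)
open import Data.List.Properties using (++-assoc; ++-identityʳ; length-++; length-drop; length-++-≤ʳ; ∷-injectiveʳ; length-tabulate)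
open import Data.List.Membership.Propositional using (_∈_; _∉_; find)
open import Data.List.Membership.Propositional.Properties
  using (∈-++⁺ˡ; ∈-++⁺ʳ; ∈-++⁻; ∈-filter⁺; ∈-filter⁻; ∈-allFin)
open import Data.List.Relation.Binary.Subset.Propositional using (_⊆_)
open import Data.List.Relation.Unary.Any using (here; there)
open import Data.List.Relation.Unary.All using (All; []; _∷_; all?)
import Data.List.Relation.Unary.All as All
open import Data.List.Relation.Unary.All.Properties using (¬Any⇒All¬; All¬⇒¬Any; ¬All⇒Any¬)
open import Data.List.Relation.Unary.AllPairs using ([]; _∷_)
open import Data.List.Relation.Unary.Unique.Propositional using (Unique)
open import Data.List.Relation.Unary.Unique.Propositional.Properties
  using (filter⁺; allFin⁺)
open import Data.Product using (∃-syntax; _×_; _,_; proj₁; proj₂)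
open import Data.Sum using (_⊎_; inj₁; inj₂; [_,_]′)
open import Data.Empty using (⊥; ⊥-elim)
open import Data.Bool.Properties using (T-≡)
open import Function.Bundles using (Equivalence)
open import Function using (_∘_; id)
open import Relation.Binary.PropositionalEquality
open import Relation.Nullary using (¬_; Dec; yes; no)
open import Relation.Nullary.Decidable using (T?; _×-dec_; _→-dec_; ¬?)

-- Duplicate-free lists and the pigeonhole principle

module _ {A : Set} where

  unique-suffix : ∀ (xs : List A) {ys} → Unique (xs ++ ys) → Unique ys
  unique-suffix []       u       = u
  unique-suffix (_ ∷ xs) (_ ∷ u) = unique-suffix xs u

  delete : ∀ {x : A} {ys} → x ∈ ys →
           ∃[ zs ] (length ys ≡ suc (length zs) × (∀ {z} → z ∈ ys → z ≢ x → z ∈ zs))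
  delete {ys = _ ∷ ys} (here refl) = ys , refl , λ { (here e) z≢x → ⊥-elim (z≢x e) ; (there m) _ → m }
  delete {ys = y ∷ _} (there x∈) with delete x∈
  ... | zs , len , keep = y ∷ zs , cong suc len ,
        λ { (here e) _ → here e ; (there m) z≢x → there (keep m z≢x) }

  unique-⊆-length : ∀ {xs ys : List A} → Unique xs → xs ⊆ ys → length xs ≤ length ys
  unique-⊆-length {[]}     _           _   = z≤n
  unique-⊆-length {x ∷ xs} {ys} (x∉ ∷ u) sub with delete {ys = ys} (sub (here refl))
  ... | zs , len , keep = subst (suc (length xs) ≤_) (sym len)
        (s≤s (unique-⊆-length u λ m → keep (sub (there m)) λ { refl → All¬⇒¬Any x∉ m }))

-- Walks in an arbitrary graph

module Walks {n : ℕ} (E : Fin n → Fin n → Bool) where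
  open import Data.List.Membership.DecPropositional (_≟_ {n}) using (_∈?_)

  Walk : Fin n → Fin n → List (Fin n) → Set
  Walk = IsWalk E

  walk-start : ∀ {x y p} → Walk x y p → x ∈ p
  walk-start single     = here refl
  walk-start (cons _ _) = here refl

  walk-length : ∀ {x y p} → Walk x y p → length p ≡ suc (length p ∸ 1)
  walk-length single     = refl
  walk-length (cons _ _) = refl

  walk-singleton : ∀ {x y z} → Walk x y (z ∷ []) → x ≡ y
  walk-singleton single = refl

  walk-snoc : ∀ {x y z p} → Walk x y p → Adj E y z → Walk x z (p ++ z ∷ [])
  walk-snoc single     yz = cons yz single
  walk-snoc (cons a w) yz = cons a (walk-snoc w yz)

  walk-++ : ∀ {x y z p q} → Walk x y p → Walk y z q → Walk x z (p ++ drop 1 q)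
  walk-++ single     single       = single
  walk-++ single     (cons yz w)  = cons yz w
  walk-++ (cons a w) w′           = cons a (walk-++ w w′)

  ∈-++-drop : ∀ {z} (p q : List (Fin n)) → z ∈ p ++ drop 1 q → z ∈ p ⊎ z ∈ q
  ∈-++-drop p []      m = inj₁ (subst (_ ∈_) (++-identityʳ p) m)
  ∈-++-drop p (_ ∷ q) m = [ inj₁ , inj₂ ∘ there ]′ (∈-++⁻ p m)

  walk-split : ∀ {x y m p} → Walk x y p → m ∈ p →
               ∃[ B ] ∃[ C ] (p ≡ B ++ m ∷ C × Walk x m (B ++ m ∷ []) × Walk m y (m ∷ C))
  walk-split single     (here refl) = [] , [] , refl , single , single
  walk-split (cons a w) (here refl) = [] , _ , refl , single , cons a w
  walk-split {x} (cons a w) (there m∈) with walk-split w m∈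
  ... | B , C , refl , w₁ , w₂ = x ∷ B , C , refl , cons a w₁ , w₂

  split-length : ∀ (B C : List (Fin n)) {m} →
                 length (B ++ m ∷ []) + length (m ∷ C) ≡ suc (length (B ++ m ∷ C))
  split-length []      C = refl
  split-length (_ ∷ B) C = cong suc (split-length B C)

  walk-to-path : ∀ {x y p} → Walk x y p → ∃[ q ] (IsPath E x y q × q ⊆ p × length q ≤ length p)
  walk-to-path single = _ , (single , [] ∷ []) , id , ≤-refl
  walk-to-path {x} (cons a w) with walk-to-path w
  ... | q , (wq , uq) , q⊆ , len with x ∈? q
  ... | no x∉q = x ∷ q , (cons a wq , ¬Any⇒All¬ q x∉q ∷ uq) ,
                 (λ { (here e) → here e ; (there m) → there (q⊆ m) }) , s≤s len
  ... | yes x∈q with walk-split wq x∈q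
  ... | B , C , refl , _ , w₂ = x ∷ C , (w₂ , unique-suffix B uq) , (λ m → there (q⊆ (∈-++⁺ʳ B m))) ,
        ≤-trans (length-++-≤ʳ (x ∷ C) {B}) (≤-trans len (n≤1+n _))

  glue-avoiding : ∀ {c x y z p q} → Walk x y p → c ∉ p → Walk y z q → c ∉ q →
                  ∃[ r ] (IsPath E x z r × c ∉ r)
  glue-avoiding {p = p} {q} wp c∉p wq c∉q with walk-to-path (walk-++ wp wq)
  ... | r , pr , r⊆ , _ = r , pr , λ c∈r → [ c∉p , c∉q ]′ (∈-++-drop p q (r⊆ c∈r))

  module _ (adj-sym : ∀ {x y} → Adj E x y → Adj E y x) where

    walk-reverse : ∀ {x y p} → Walk x y p → ∃[ q ] (Walk y x q × length q ≡ length p × q ⊆ p)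
    walk-reverse single = _ , single , refl , id
    walk-reverse {x} (cons a w) with walk-reverse w
    ... | q , wq , len , q⊆ = q ++ x ∷ [] , walk-snoc wq (adj-sym a) ,
          trans (length-++ q) (trans (+-comm (length q) 1) (cong suc len)) ,
          λ m → [ there ∘ q⊆ , (λ { (here e) → here e }) ]′ (∈-++⁻ q m)

    reverse-avoiding : ∀ {c x y p} → Walk x y p → c ∉ p → ∃[ q ] (Walk y x q × c ∉ q)
    reverse-avoiding w c∉p with walk-reverse w
    ... | q , wq , _ , q⊆ = q , wq , c∉p ∘ q⊆

-- Counting neighbours

module Degree {n : ℕ} (E : Fin n → Fin n → Bool) where
  open import Data.List.Membership.DecPropositional (_≟_ {n}) using (_∈?_)

  neighbours : Fin n → List (Fin n)
  neighbours v = filterᵇ (E v) (allFin n)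

  neighbours-unique : ∀ v → Unique (neighbours v)
  neighbours-unique v = filter⁺ (T? ∘ E v) (allFin⁺ n)

  ∈-neighbours : ∀ {v x} → Adj E v x → x ∈ neighbours v
  ∈-neighbours {v} {x} vx = ∈-filter⁺ (T? ∘ E v) (∈-allFin x) (Equivalence.from T-≡ vx)

  ∈-neighbours⁻ : ∀ {v x} → x ∈ neighbours v → Adj E v x
  ∈-neighbours⁻ {v} m = Equivalence.to T-≡ (proj₂ (∈-filter⁻ (T? ∘ E v) {xs = allFin n} m))

  deg-≥ : ∀ {v} (xs : List (Fin n)) → Unique xs → (∀ {z} → z ∈ xs → Adj E v z) → length xs ≤ deg E v
  deg-≥ xs u adj = unique-⊆-length u (∈-neighbours ∘ adj)

  three-neighbours⇒core : ∀ {v a b c} → Adj E v a → Adj E v b → Adj E v c →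
                          a ≢ b → a ≢ c → b ≢ c → Core E v
  three-neighbours⇒core va vb vc a≢b a≢c b≢c =
    deg-≥ (_ ∷ _ ∷ _ ∷ []) ((a≢b ∷ a≢c ∷ []) ∷ (b≢c ∷ []) ∷ [] ∷ [])
      λ { (here refl) → va ; (there (here refl)) → vb ; (there (there (here refl))) → vc }

  core⇒three-neighbours : ∀ {v} → Core E v →
    ∃[ a ] ∃[ b ] ∃[ c ] (Adj E v a × Adj E v b × Adj E v c × a ≢ b × a ≢ c × b ≢ c)
  core⇒three-neighbours {v} deg≥3 with neighbours v | neighbours-unique v | ∈-neighbours⁻ {v}
  ... | a ∷ b ∷ c ∷ _ | (a≢b ∷ a≢c ∷ _) ∷ (b≢c ∷ _) ∷ _ | adj =
      a , b , c , adj (here refl) , adj (there (here refl)) , adj (there (there (here refl))) ,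
      a≢b , a≢c , b≢c
  core⇒three-neighbours (s≤s (s≤s ())) | _ ∷ _ ∷ [] | _ | _
  core⇒three-neighbours (s≤s ()) | _ ∷ [] | _ | _
  core⇒three-neighbours () | [] | _ | _

  missed-neighbour : ∀ {v} (ys : List (Fin n)) → length ys < deg E v → ∃[ h ] (Adj E v h × h ∉ ys)
  missed-neighbour {v} ys short with all? (_∈? ys) (neighbours v)
  ... | yes all∈ = ⊥-elim (<⇒≱ short (unique-⊆-length (neighbours-unique v) (All.lookup all∈)))
  ... | no ¬all with find (¬All⇒Any¬ (_∈? ys) (neighbours v) ¬all)
  ... | h , h∈ , h∉ = h , ∈-neighbours⁻ h∈ , h∉

  four-neighbours : ∀ {v a b c e} → Adj E v a → Adj E v b → Adj E v c → Adj E v e →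
                    a ≢ b → a ≢ c → a ≢ e → b ≢ c → b ≢ e → c ≢ e → 4 ≤ deg E v
  four-neighbours va vb vc ve a≢b a≢c a≢e b≢c b≢e c≢e =
    deg-≥ (_ ∷ _ ∷ _ ∷ _ ∷ [])
      ((a≢b ∷ a≢c ∷ a≢e ∷ []) ∷ (b≢c ∷ b≢e ∷ []) ∷ (c≢e ∷ []) ∷ [] ∷ [])
      λ { (here refl) → va ; (there (here refl)) → vb ; (there (there (here refl))) → vc
        ; (there (there (there (here refl)))) → ve }

  degree-3-neighbours : ∀ {v a b c h} → deg E v ≡ 3 → Adj E v a → Adj E v b → Adj E v c → Adj E v h →
                        a ≢ b → a ≢ c → b ≢ c → h ≡ a ⊎ h ≡ b ⊎ h ≡ c
  degree-3-neighbours {a = a} {b} {c} {h} deg≡3 va vb vc vh a≢b a≢c b≢c with h ≟ a | h ≟ b | h ≟ c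
  ... | yes h≡a | _ | _ = inj₁ h≡a
  ... | no _ | yes h≡b | _ = inj₂ (inj₁ h≡b)
  ... | no _ | no _ | yes h≡c = inj₂ (inj₂ h≡c)
  ... | no h≢a | no h≢b | no h≢c = ⊥-elim (<-irrefl refl (subst (4 ≤_) deg≡3
        (four-neighbours va vb vc vh a≢b a≢c (h≢a ∘ sym) b≢c (h≢b ∘ sym) (h≢c ∘ sym))))

-- The path metric of a tree and the branches at a vertex

module Tree {n : ℕ} (E : Fin n → Fin n → Bool) (tree : IsTree E) where
  open Walks E public
  open Degree E public
  open import Data.List.Membership.DecPropositional (_≟_ {n}) using (_∈?_)

  adj-sym : ∀ {x y} → Adj E x y → Adj E y x
  adj-sym {x} {y} xy = trans (sym (proj₁ tree x y)) xy

  adj-≢ : ∀ {x y} → Adj E x y → x ≢ y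
  adj-≢ {x} xx refl with trans (sym xx) (proj₁ (proj₂ tree) x)
  ... | ()

  path : Fin n → Fin n → List (Fin n)
  path x y = proj₁ (proj₁ (proj₂ (proj₂ tree)) x y)

  path-isPath : ∀ x y → IsPath E x y (path x y)
  path-isPath x y = proj₂ (proj₁ (proj₂ (proj₂ tree)) x y)

  path-walk : ∀ x y → Walk x y (path x y)
  path-walk x y = proj₁ (path-isPath x y)

  path-unique : ∀ {x y p} → IsPath E x y p → p ≡ path x y
  path-unique {x} {y} {p} pp = proj₂ (proj₂ (proj₂ tree)) x y p (path x y) pp (path-isPath x y)

  d : Fin n → Fin n → ℕ
  d x y = length (path x y) ∸ 1

  d-path : ∀ {x y p} → IsPath E x y p → length p ≡ suc (d x y)
  d-path {x} {y} pp rewrite path-unique pp = walk-length (path-walk x y)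

  d⇒Dist : ∀ x y → Dist E x y (d x y)
  d⇒Dist x y = path x y , path-isPath x y , walk-length (path-walk x y)

  Dist⇒d : ∀ {x y k} → Dist E x y k → d x y ≡ k
  Dist⇒d (p , pp , len) = suc-injective (trans (sym (d-path pp)) len)

  d-walk : ∀ {x y p} → Walk x y p → suc (d x y) ≤ length p
  d-walk w with walk-to-path w
  ... | q , pq , _ , len = subst (_≤ _) (d-path pq) len

  d-sym : ∀ x y → d x y ≡ d y x
  d-sym x y = ≤-antisym (d-sym-≤ x y) (d-sym-≤ y x)
    where
    d-sym-≤ : ∀ x y → d x y ≤ d y x
    d-sym-≤ x y with walk-reverse adj-sym (path-walk y x)
    ... | q , wq , len , _ =
      s≤s⁻¹ (subst (suc (d x y) ≤_) (trans len (walk-length (path-walk y x))) (d-walk wq))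

  d-triangle : ∀ x y z → d x z ≤ d x y + d y z
  d-triangle x y z = s≤s⁻¹ (begin
    suc (d x z)                               ≤⟨ d-walk (walk-++ (path-walk x y) (path-walk y z)) ⟩
    length (path x y ++ drop 1 (path y z))    ≡⟨ length-++ (path x y) ⟩
    length (path x y) + length (drop 1 (path y z))
                                              ≡⟨ cong₂ _+_ (walk-length (path-walk x y)) (length-drop 1 (path y z)) ⟩
    suc (d x y + d y z)                       ∎)
    where open ≤-Reasoning

  d-refl : ∀ x → d x x ≡ 0
  d-refl x = suc-injective (sym (d-path {p = x ∷ []} (single , [] ∷ [])))

  d≡0⇒≡ : ∀ {x y} → d x y ≡ 0 → x ≡ y
  d≡0⇒≡ {x} {y} e with path x y | path-walk x y
  ... | _ | single = refl
  d≡0⇒≡ () | _ | cons _ single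
  d≡0⇒≡ () | _ | cons _ (cons _ _)

  d-split : ∀ {x z m} → m ∈ path x z → d x z ≡ d x m + d m z
  d-split {x} {z} {m} m∈ with walk-split (path-walk x z) m∈
  ... | B , C , eq , w₁ , w₂ = ≤-antisym (d-triangle x m z) (s≤s⁻¹ (s≤s⁻¹ (begin
    suc (suc (d x m + d m z))               ≡⟨ cong suc (sym (+-suc (d x m) (d m z))) ⟩
    suc (d x m) + suc (d m z)               ≤⟨ +-mono-≤ (d-walk w₁) (d-walk w₂) ⟩
    length (B ++ m ∷ []) + length (m ∷ C)   ≡⟨ split-length B C ⟩
    suc (length (B ++ m ∷ C))               ≡⟨ cong (suc ∘ length) (sym eq) ⟩
    suc (length (path x z))                 ≡⟨ cong suc (walk-length (path-walk x z)) ⟩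
    suc (suc (d x z))                       ∎)))
    where open ≤-Reasoning

  d-≤-split : ∀ {x z m} → m ∈ path x z → d x m ≤ d x z
  d-≤-split {x} {z} {m} m∈ = subst (d x m ≤_) (sym (d-split m∈)) (m≤m+n _ _)

  on-path-same-distance : ∀ {v x y} → x ∈ path v y → d v x ≡ d v y → x ≡ y
  on-path-same-distance {v} {x} {y} x∈ e = d≡0⇒≡ (+-cancelˡ-≡ (d v x) (d x y) 0
    (trans (sym (d-split x∈)) (trans (sym e) (sym (+-identityʳ _)))))

  branch-≢ : ∀ {v a x} → InSub E v a x → x ≢ v
  branch-≢ (_ , _ , w , v∉p) refl = v∉p (walk-end w)
    where
    walk-end : ∀ {x y p} → Walk x y p → y ∈ p
    walk-end single     = here refl
    walk-end (cons _ w) = there (walk-end w)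

  branch-root : ∀ {v a} → Adj E v a → InSub E v a a
  branch-root va = va , _ ∷ [] , single , λ { (here v≡a) → adj-≢ va v≡a }

  avoiding-path : ∀ {c x y p} → Walk x y p → c ∉ p → c ∉ path x y
  avoiding-path w c∉p with walk-to-path w
  ... | q , pq , q⊆ , _ = subst (_ ∉_) (path-unique pq) (c∉p ∘ q⊆)

  branch-unique : ∀ {v a b x} → InSub E v a x → InSub E v b x → a ≡ b
  branch-unique {v} {a} {b} (va , p , wp , v∉p) (vb , q , wq , v∉q) with reverse-avoiding adj-sym wq v∉q
  ... | q′ , wq′ , v∉q′ with glue-avoiding wp v∉p wq′ v∉q′
  ... | r , (wr , ur) , v∉r = walk-singleton (subst (Walk a b) r≡[b] wr)
    where
    r≡[b] : r ≡ b ∷ []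
    r≡[b] = ∷-injectiveʳ (trans (path-unique (cons va wr , ¬Any⇒All¬ r v∉r ∷ ur))
                                (sym (path-unique (cons vb single , (adj-≢ vb ∷ []) ∷ [] ∷ []))))

  first-step : ∀ {v x} → x ≢ v → ∃[ h ] (Adj E v h × InSub E v h x × d v x ≡ suc (d h x))
  first-step {v} {x} x≢v with path v x | path-walk v x | proj₂ (path-isPath v x)
  ... | _ | single       | _          = ⊥-elim (x≢v refl)
  ... | _ | cons vh w    | v∉p ∷ uniq =
        _ , vh , (vh , _ , w , All¬⇒¬Any v∉p) , d-path (w , uniq)

  d-branch : ∀ {v a x} → InSub E v a x → d v x ≡ suc (d a x)
  d-branch x∈a with first-step (branch-≢ x∈a)
  ... | h , _ , x∈h , e with branch-unique x∈a x∈h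
  ... | refl = e

  d-adj : ∀ {v a} → Adj E v a → d v a ≡ 1
  d-adj va = trans (d-branch (branch-root va)) (cong suc (d-refl _))

  branch-at-distance-1 : ∀ {v b y} → InSub E v b y → d v y ≡ 1 → y ≡ b
  branch-at-distance-1 y∈b e = sym (d≡0⇒≡ (suc-injective (trans (sym (d-branch y∈b)) e)))

  same-branch-avoids : ∀ {c h x y} → InSub E c h x → InSub E c h y → c ∉ path x y
  same-branch-avoids (_ , p , wp , c∉p) (_ , q , wq , c∉q) with reverse-avoiding adj-sym wp c∉p
  ... | p′ , wp′ , c∉p′ with glue-avoiding wp′ c∉p′ wq c∉q
  ... | r , pr , c∉r = subst (_ ∉_) (path-unique pr) c∉r

  leave-branch : ∀ {c a x τ} → InSub E c a x → ¬ InSub E c a τ → c ∈ path x τ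
  leave-branch {c} {a} {x} {τ} (ca , p , wp , c∉p) τ∉a with c ∈? path x τ
  ... | yes c∈ = c∈
  ... | no c∉ with glue-avoiding wp c∉p (path-walk x τ) c∉
  ... | r , (wr , _) , c∉r = ⊥-elim (τ∉a (ca , r , wr , c∉r))

  d-through : ∀ {c a x τ} → InSub E c a x → ¬ InSub E c a τ → d x τ ≡ d x c + d c τ
  d-through x∈a τ∉a = d-split (leave-branch x∈a τ∉a)

  walk-in-branch : ∀ {s a x m p} → Walk a x p → s ∉ p → Adj E s a → m ∈ p → InSub E s a m
  walk-in-branch w s∉p sa m∈ with walk-split w m∈
  ... | B , C , refl , w₁ , _ = sa , _ , w₁ , λ s∈ → s∉p (subst (_ ∈_) (++-assoc B (_ ∷ []) C) (∈-++⁺ˡ s∈))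

  path-in-branch : ∀ {s a x m} → InSub E s a x → m ∈ path s x → m ≢ s → InSub E s a m
  path-in-branch {s} {a} {x} x∈a m∈ m≢s with path s x | path-walk s x | proj₂ (path-isPath s x)
  ... | _ | single     | _       = ⊥-elim (branch-≢ x∈a refl)
  ... | _ | cons sh w  | s∉p ∷ _ with m∈
  ...   | here m≡s = ⊥-elim (m≢s m≡s)
  ...   | there m∈p with branch-unique x∈a (sh , _ , w , All¬⇒¬Any s∉p)
  ...     | refl = walk-in-branch w (All¬⇒¬Any s∉p) sh m∈p

  path-via-branch : ∀ {s a x} → InSub E s a x → path s x ≡ s ∷ path a x
  path-via-branch {s} {a} {x} x∈a@(sa , _) = sym (path-unique
    (cons sa (path-walk a x) ,
     ¬Any⇒All¬ _ (same-branch-avoids (branch-root sa) x∈a) ∷ proj₂ (path-isPath a x)))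

  via-branch : ∀ {s a z} → InSub E s a z → path a z ⊆ path s z
  via-branch z∈a m∈ = subst (_ ∈_) (sym (path-via-branch z∈a)) (there m∈)

  root-on-path : ∀ {s a z} → InSub E s a z → a ∈ path s z
  root-on-path {a = a} {z} z∈a = via-branch z∈a (walk-start (path-walk a z))

  branch-extend : ∀ {m h z z′} → InSub E m h z → Adj E z z′ → z′ ≢ m → InSub E m h z′
  branch-extend (mh , p , w , m∉p) zz′ z′≢m =
    mh , _ , walk-snoc w zz′ , λ m∈ → [ m∉p , (λ { (here m≡z′) → z′≢m (sym m≡z′) }) ]′ (∈-++⁻ p m∈)

  not-back : ∀ {s a x} → InSub E s a x → ¬ InSub E a s x
  not-back {s} {a} {x} x∈a x∈s = m≢1+m+n (d s x)
    (trans (d-branch x∈a) (cong suc (trans (d-branch x∈s) (+-comm 1 (d s x)))))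

  Fork : Fin n → Fin n → Fin n → Fin n → Set
  Fork s x y m = ∃[ h₀ ] ∃[ h₁ ] ∃[ h₂ ] (h₀ ≢ h₁ × h₀ ≢ h₂ × h₁ ≢ h₂
                                         × InSub E m h₀ s × InSub E m h₁ x × InSub E m h₂ y)

  fork⇒core : ∀ {s x y m} → Fork s x y m → Core E m
  fork⇒core (_ , _ , _ , h₀≢h₁ , h₀≢h₂ , h₁≢h₂ , (m₀ , _) , (m₁ , _) , (m₂ , _)) =
    three-neighbours⇒core m₀ m₁ m₂ h₀≢h₁ h₀≢h₂ h₁≢h₂

  fork : ∀ {s a x y} → InSub E s a x → InSub E s a y → x ∉ path s y → y ∉ path s x →
         ∃[ m ] (m ∈ path s x × m ∈ path s y × InSub E s a m × Fork s x y m)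
  fork x∈a = fork-at _ refl x∈a
    where
    -- induction on the distance k from s to x, moving s one step towards x
    fork-at : ∀ k {s a x y} → d s x ≡ k → InSub E s a x → InSub E s a y → x ∉ path s y → y ∉ path s x →
              ∃[ m ] (m ∈ path s x × m ∈ path s y × InSub E s a m × Fork s x y m)
    fork-at zero    e x∈a _ _ _ = ⊥-elim (branch-≢ x∈a (sym (d≡0⇒≡ e)))
    fork-at (suc k) {s} {a} {x} {y} e x∈a@(sa , _) y∈a x∉ y∉
      with first-step {a} {x} (λ { refl → x∉ (root-on-path y∈a) })
         | first-step {a} {y} (λ { refl → y∉ (root-on-path x∈a) })
    ... | h₁ , _ , x∈h₁ , _ | h₂ , _ , y∈h₂ , _ with h₁ ≟ h₂
    ...   | no h₁≢h₂ =
            a , root-on-path x∈a , root-on-path y∈a ,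
            branch-root sa ,
            (s , h₁ , h₂ , (λ { refl → not-back x∈a x∈h₁ }) , (λ { refl → not-back y∈a y∈h₂ }) , h₁≢h₂ ,
             branch-root (adj-sym sa) , x∈h₁ , y∈h₂)
    ...   | yes refl
      with fork-at k (suc-injective (trans (sym (d-branch x∈a)) e)) x∈h₁ y∈h₂
                   (x∉ ∘ via-branch y∈a) (y∉ ∘ via-branch x∈a)
    ...   | m , m∈x , m∈y , _ , (h₀ , h₁′ , h₂′ , n₀₁ , n₀₂ , n₁₂ , a∈h₀ , x∈h₁′ , y∈h₂′) =
            m , via-branch x∈a m∈x , via-branch y∈a m∈y , path-in-branch x∈a (via-branch x∈a m∈x) m≢s ,
            (h₀ , h₁′ , h₂′ , n₀₁ , n₀₂ , n₁₂ , branch-extend a∈h₀ (adj-sym sa) (m≢s ∘ sym) , x∈h₁′ , y∈h₂′)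
      where
      m≢s : m ≢ s
      m≢s refl = same-branch-avoids (branch-root sa) x∈a m∈x

  equal-beyond : ∀ {v w x y} → w ∈ path v x → w ∈ path v y → d v x ≡ d v y → d w x ≡ d w y
  equal-beyond {v} {w} {x} {y} w∈x w∈y e =
    +-cancelˡ-≡ (d v w) (d w x) (d w y) (trans (sym (d-split w∈x)) (trans e (d-split w∈y)))

  branch-dichotomy : ∀ {v a x y} → InSub E v a x → InSub E v a y →
    x ∈ path v y ⊎ y ∈ path v x ⊎ ∃[ m ] (Core E m × InSub E v a m × m ∈ path v x × m ∈ path v y)
  branch-dichotomy {v} {a} {x} {y} x∈a y∈a with x ∈? path v y | y ∈? path v x
  ... | yes x∈ | _      = inj₁ x∈
  ... | no _   | yes y∈ = inj₂ (inj₁ y∈)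
  ... | no x∉  | no y∉ with fork x∈a y∈a x∉ y∉
  ... | m , m∈x , m∈y , m∈a , f = inj₂ (inj₂ (m , fork⇒core f , m∈a , m∈x , m∈y))

  equidistant-core : ∀ {v a x y} → InSub E v a x → InSub E v a y → x ≢ y → d v x ≡ d v y →
    ∃[ m ] (Core E m × InSub E v a m × m ∈ path v x × m ∈ path v y)
  equidistant-core x∈a y∈a x≢y e with branch-dichotomy x∈a y∈a
  ... | inj₁ x∈ = ⊥-elim (x≢y (on-path-same-distance x∈ e))
  ... | inj₂ (inj₁ y∈) = ⊥-elim (x≢y (sym (on-path-same-distance y∈ (sym e))))
  ... | inj₂ (inj₂ c) = c

  leg-position-injective : ∀ {v a x y} → Leg E v a → InSub E v a x → InSub E v a y → d v x ≡ d v y → x ≡ y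
  leg-position-injective {x = x} {y} (_ , no-core) x∈a y∈a e with x ≟ y
  ... | yes x≡y = x≡y
  ... | no x≢y with equidistant-core x∈a y∈a x≢y e
  ... | m , m-core , m∈a , _ = ⊥-elim (no-core m m∈a m-core)

  modleg-dichotomy : ∀ {v a w z} → ModLeg E v a w → InSub E v a z → z ∈ path v w ⊎ w ∈ path v z
  modleg-dichotomy (_ , w∈a , _ , unique-core) z∈a with branch-dichotomy z∈a w∈a
  ... | inj₁ z∈ = inj₁ z∈
  ... | inj₂ (inj₁ w∈) = inj₂ w∈
  ... | inj₂ (inj₂ (m , m-core , m∈a , m∈z , _)) with unique-core m m∈a m-core
  ... | refl = inj₂ m∈z

  closer-in-own-branch : ∀ {v a b x y τ} → InSub E v a x → InSub E v b y → a ≢ b → d v x ≡ d v y →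
                         InSub E v a τ → d x τ < d y τ
  closer-in-own-branch {v} {a} {b} {x} {y} {τ} x∈a y∈b a≢b e τ∈a = begin-strict
    d x τ                      ≤⟨ d-triangle x a τ ⟩
    d x a + d a τ              ≡⟨ cong (_+ d a τ) (d-sym x a) ⟩
    d a x + d a τ              <⟨ s≤s (+-monoʳ-≤ (d a x) (n≤1+n _)) ⟩
    suc (d a x) + suc (d a τ)  ≡⟨ cong₂ _+_ (trans (sym (d-branch x∈a)) (trans e (d-sym v y)))
                                             (sym (d-branch τ∈a)) ⟩
    d y v + d v τ              ≡⟨ sym (d-through y∈b (λ τ∈b → a≢b (branch-unique τ∈a τ∈b))) ⟩
    d y τ                      ∎
    where open ≤-Reasoning

  module ModLegAnatomy {v a w a₁ a₂} (v-core : Core E v) (modleg : ModLeg E v a w)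
    (deg≡3 : deg E w ≡ 3) (a₁≢a₂ : a₁ ≢ a₂) (leg₁ : Leg E w a₁) (leg₂ : Leg E w a₂)
    (short₁ : ShortLeg E w a₁) where

    w∈a : InSub E v a w
    w∈a = proj₁ (proj₂ modleg)

    towards-v : ∃[ p ] (Adj E w p × InSub E w p v × d w v ≡ suc (d p v))
    towards-v = first-step (branch-≢ w∈a ∘ sym)

    p : Fin n
    p = proj₁ towards-v

    v∈p : InSub E w p v
    v∈p = proj₁ (proj₂ (proj₂ towards-v))

    -- The legs of w contain no core, whereas the branch of w at p contains v.
    p≢leg : ∀ {b} → Leg E w b → p ≢ b
    p≢leg (_ , no-core) refl = no-core v v∈p v-core

    neighbours-of-w : ∀ {h} → Adj E w h → h ≡ p ⊎ h ≡ a₁ ⊎ h ≡ a₂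
    neighbours-of-w wh = degree-3-neighbours deg≡3 (proj₁ (proj₂ towards-v)) (proj₁ leg₁) (proj₁ leg₂) wh
                           (p≢leg leg₁) (p≢leg leg₂) a₁≢a₂

    beyond : ∀ {z} → w ∈ path v z → z ≢ w → InSub E w a₁ z ⊎ InSub E w a₂ z
    beyond w∈ z≢w with first-step z≢w
    ... | h , wh , z∈h , _ with neighbours-of-w wh
    ... | inj₁ refl        = ⊥-elim (same-branch-avoids v∈p z∈h w∈)
    ... | inj₂ (inj₁ refl) = inj₁ z∈h
    ... | inj₂ (inj₂ refl) = inj₂ z∈h

    on-short-leg : ∀ {z} → InSub E w a₁ z → z ≡ a₁
    on-short-leg = proj₂ short₁ _

    next-to-core : ∀ {z} → InSub E v a z → d v z ≡ suc (d v w) → z ≡ a₁ ⊎ z ≡ a₂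
    next-to-core {z} z∈a e with modleg-dichotomy modleg z∈a
    ... | inj₁ z∈ = ⊥-elim (<-irrefl refl (subst (_≤ d v w) e (d-≤-split z∈)))
    ... | inj₂ w∈ with +-cancelˡ-≡ (d v w) (d w z) 1 (trans (sym (d-split w∈)) (trans e (+-comm 1 _)))
    ... | dwz≡1 with beyond w∈ (λ { refl → 0≢1+n (trans (sym (d-refl w)) dwz≡1) })
    ...   | inj₁ z∈a₁ = inj₁ (on-short-leg z∈a₁)
    ...   | inj₂ z∈a₂ = inj₂ (branch-at-distance-1 z∈a₂ dwz≡1)

    far-from-core : ∀ {z} → InSub E v a z → suc (suc (d v w)) ≤ d v z → InSub E w a₂ z
    far-from-core {z} z∈a le with modleg-dichotomy modleg z∈a
    ... | inj₁ z∈ = ⊥-elim (<-irrefl refl (≤-trans (n≤1+n _) (≤-trans le (d-≤-split z∈))))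
    ... | inj₂ w∈ with beyond w∈ (λ { refl → <-irrefl refl (≤-trans (n≤1+n _) le) })
    ...   | inj₂ z∈a₂ = z∈a₂
    ...   | inj₁ z∈a₁ with on-short-leg z∈a₁
    ...     | refl = ⊥-elim (<-irrefl refl (≤-trans (subst (suc (suc (d v w)) ≤_)
              (trans (d-split w∈) (cong (d v w +_) (d-adj (proj₁ leg₁)))) le) (≤-reflexive (+-comm _ 1))))

    equidistant-pair : ∀ {x y} → InSub E v a x → InSub E v a y → x ≢ y → d v x ≡ d v y →
                       (x ≡ a₁ × y ≡ a₂) ⊎ (x ≡ a₂ × y ≡ a₁)
    equidistant-pair {x} {y} x∈a y∈a x≢y e with equidistant-core x∈a y∈a x≢y e
    ... | m , m-core , m∈a , w∈x , w∈y with proj₂ (proj₂ (proj₂ modleg)) m m∈a m-core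
    ... | refl with beyond w∈x x≢w | beyond w∈y y≢w
      where
      x≢w : x ≢ w
      x≢w refl = x≢y (on-path-same-distance w∈y e)
      y≢w : y ≢ w
      y≢w refl = x≢y (sym (on-path-same-distance w∈x (sym e)))
    ... | inj₁ x∈a₁ | inj₁ y∈a₁ = ⊥-elim (x≢y (trans (on-short-leg x∈a₁) (sym (on-short-leg y∈a₁))))
    ... | inj₂ x∈a₂ | inj₂ y∈a₂ = ⊥-elim (x≢y (leg-position-injective leg₂ x∈a₂ y∈a₂ (equal-beyond w∈x w∈y e)))
    ... | inj₁ x∈a₁ | inj₂ y∈a₂ = inj₁ (on-short-leg x∈a₁ , branch-at-distance-1 y∈a₂
          (trans (sym (equal-beyond w∈x w∈y e)) (trans (cong (d w) (on-short-leg x∈a₁)) (d-adj (proj₁ leg₁)))))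
    ... | inj₂ x∈a₂ | inj₁ y∈a₁ = inj₂ (branch-at-distance-1 x∈a₂
          (trans (equal-beyond w∈x w∈y e) (trans (cong (d w) (on-short-leg y∈a₁)) (d-adj (proj₁ leg₁)))) ,
          on-short-leg y∈a₁)

  GLeg : Fin n → Fin n → Set
  GLeg c b = Leg E c b ⊎ ∃[ w ] ModLeg E c b w

  Adj? : ∀ x y → Dec (Adj E x y)
  Adj? x y = E x y Bool.≟ true

  InSub? : ∀ v a x → Dec (InSub E v a x)
  InSub? v a x with Adj? v a | v ∈? path a x
  ... | no ¬va | _      = no (¬va ∘ proj₁)
  ... | yes va | no v∉  = yes (va , path a x , path-walk a x , v∉)
  ... | yes _  | yes v∈ = no λ { (_ , _ , w , v∉p) → avoiding-path w v∉p v∈ }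

  Core? : ∀ v → Dec (Core E v)
  Core? v = 3 ≤? deg E v

  Leg? : ∀ v a → Dec (Leg E v a)
  Leg? v a = Adj? v a ×-dec all-Fin? (λ x → InSub? v a x →-dec ¬? (Core? x))

  Short? : ∀ v a → Dec (∀ x → InSub E v a x → x ≡ a)
  Short? v a = all-Fin? (λ x → InSub? v a x →-dec (x ≟ a))

  SmallCore? : ∀ w → Dec (SmallCore E w)
  SmallCore? w = (deg E w ≟ℕ 3) ×-dec any-Fin? (λ a → any-Fin? (λ b →
    ¬? (a ≟ b) ×-dec Leg? w a ×-dec Leg? w b ×-dec (Leg? w a ×-dec Short? w a)))

  RegularCore? : ∀ v → Dec (RegularCore E v)
  RegularCore? v = Core? v ×-dec ¬? (SmallCore? v)

  small⇒core : ∀ {w} → SmallCore E w → Core E w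
  small⇒core (deg≡3 , _) = ≤-reflexive (sym deg≡3)

  -- A core that is not regular is small (SmallCore is decidable).
  non-regular-core⇒small : ∀ {c} → Core E c → ¬ RegularCore E c → SmallCore E c
  non-regular-core⇒small {c} c-core ¬reg with SmallCore? c
  ... | yes small = small
  ... | no ¬small = ⊥-elim (¬reg (c-core , ¬small))

  d<n : ∀ x y → d x y < n
  d<n x y = subst (suc (d x y) ≤_) (length-tabulate id)
    (subst (_≤ length (allFin n)) (d-path (path-isPath x y))
      (unique-⊆-length (proj₂ (path-isPath x y)) (λ {z} _ → ∈-allFin z)))

  further-away : ∀ {u b v z} → InSub E u b z → ¬ InSub E u b v → d v u < d v z
  further-away {u} {b} {v} {z} z∈b v∉b = begin-strict
    d v u          <⟨ m<m+n (d v u) (subst (0 <_) (sym (d-branch z∈b)) (s≤s z≤n)) ⟩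
    d v u + d u z  ≡⟨ +-comm (d v u) (d u z) ⟩
    d u z + d v u  ≡⟨ cong₂ _+_ (d-sym u z) (d-sym v u) ⟩
    d z u + d u v  ≡⟨ sym (d-through z∈b v∉b) ⟩
    d z v          ≡⟨ d-sym z v ⟩
    d v z          ∎
    where open ≤-Reasoning

  Extremal : Fin n → Fin n → Set
  Extremal v u = ∀ b z → Adj E u b → ¬ InSub E u b v → InSub E u b z → ¬ RegularCore E z

  -- Walking away from v through regular cores must stop at an extremal one.
  extremal-core : ∀ {v r} → RegularCore E r → r ≢ v → ∃[ u ] (RegularCore E u × u ≢ v × Extremal v u)
  extremal-core {v} {r} r-reg r≢v = climb n r r-reg r≢v (m≤m+n n (d v r))
    where
    -- the fuel k bounds the number of remaining steps, because d v u < n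
    climb : ∀ k u → RegularCore E u → u ≢ v → n ≤ k + d v u →
            ∃[ u′ ] (RegularCore E u′ × u′ ≢ v × Extremal v u′)
    climb k u u-reg u≢v bound with any-Fin? (λ b → any-Fin? (λ z →
      Adj? u b ×-dec ¬? (InSub? u b v) ×-dec InSub? u b z ×-dec RegularCore? z))
    ... | no none = u , u-reg , u≢v , λ b z ub v∉b z∈b z-reg → none (b , z , ub , v∉b , z∈b , z-reg)
    ... | yes (b , z , _ , v∉b , z∈b , z-reg) with k
    ...   | zero   = ⊥-elim (<⇒≱ (d<n v u) bound)
    ...   | suc k′ = climb k′ z z-reg (λ { refl → v∉b z∈b }) (≤-trans bound (begin
            suc k′ + d v u  ≡⟨ sym (+-suc k′ (d v u)) ⟩
            k′ + suc (d v u) ≤⟨ +-monoʳ-≤ k′ (further-away z∈b v∉b) ⟩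
            k′ + d v z       ∎))
      where open ≤-Reasoning

  -- Only one branch of a small core contains cores: the other two are its legs.
  small-core-blocks : ∀ {s h h′ x y} → SmallCore E s → InSub E s h x → Core E x →
                      InSub E s h′ y → Core E y → h ≡ h′
  small-core-blocks {s} {h} {h′} (deg≡3 , a₁ , a₂ , a₁≢a₂ , leg₁ , leg₂ , _) x∈h x-core y∈h′ y-core
    with h ≟ h′
  ... | yes h≡h′ = h≡h′
  ... | no h≢h′ = ⊥-elim (<-irrefl refl (subst (4 ≤_) deg≡3
        (four-neighbours (proj₁ x∈h) (proj₁ y∈h′) (proj₁ leg₁) (proj₁ leg₂) h≢h′
          (not-leg x∈h x-core leg₁) (not-leg x∈h x-core leg₂)
          (not-leg y∈h′ y-core leg₁) (not-leg y∈h′ y-core leg₂) a₁≢a₂)))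
    where
    not-leg : ∀ {g z b} → InSub E s g z → Core E z → Leg E s b → g ≢ b
    not-leg z∈g z-core (_ , no-core) refl = no-core _ z∈g z-core

  small-core-not-between : ∀ {s x y} → SmallCore E s → Core E x → Core E y → s ∈ path x y →
                           x ≢ s → y ≢ s → ⊥
  small-core-not-between small x-core y-core s∈ x≢s y≢s with first-step x≢s | first-step y≢s
  ... | _ , _ , x∈h , _ | _ , _ , y∈h′ , _ with small-core-blocks small x∈h x-core y∈h′ y-core
  ... | refl = same-branch-avoids x∈h y∈h′ s∈

  short-beside⇒small : ∀ {c a b} → deg E c ≡ 3 → a ≢ b → Leg E c a → Leg E c b →
                       ShortLeg E c a ⊎ ShortLeg E c b → SmallCore E c
  short-beside⇒small deg≡3 a≢b leg-a leg-b (inj₁ short-a) = deg≡3 , _ , _ , a≢b , leg-a , leg-b , short-a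
  short-beside⇒small deg≡3 a≢b leg-a leg-b (inj₂ short-b) = deg≡3 , _ , _ , a≢b ∘ sym , leg-b , leg-a , short-b

  gleg-no-regular : ∀ {v a u} → GLeg v a → InSub E v a u → ¬ RegularCore E u
  gleg-no-regular (inj₁ (_ , no-core)) u∈a (u-core , _) = no-core _ u∈a u-core
  gleg-no-regular (inj₂ (w , _ , _ , small , unique-core)) u∈a (u-core , ¬small)
    with unique-core _ u∈a u-core
  ... | refl = ¬small small

  branch-transfer : ∀ {v t u b τ} → InSub E v t u → InSub E u b τ → ¬ InSub E u b v → InSub E v t τ
  branch-transfer {v} (vt , q , wq , v∉q) τ∈b@(ub , p , wp , u∉p) v∉b
    with glue-avoiding wq v∉q (cons ub wp) v∉u∷p
    where
    v∉u∷p : v ∉ _ ∷ p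
    v∉u∷p (here v≡u) = branch-≢ (vt , q , wq , v∉q) (sym v≡u)
    v∉u∷p (there v∈p) = v∉b (walk-in-branch wp u∉p ub v∈p)
  ... | r , (wr , _) , v∉r = vt , r , wr , v∉r

  TwoIn : (L P : Fin n → Set) → Set
  TwoIn L P = ∃[ τ₁ ] ∃[ τ₂ ] (τ₁ ≢ τ₂ × L τ₁ × L τ₂ × P τ₁ × P τ₂)

  TwoIn-map : ∀ {L P Q} → (∀ {τ} → P τ → Q τ) → TwoIn L P → TwoIn L Q
  TwoIn-map f (τ₁ , τ₂ , τ₁≢τ₂ , L₁ , L₂ , P₁ , P₂) = τ₁ , τ₂ , τ₁≢τ₂ , L₁ , L₂ , f P₁ , f P₂

  module LocalSetAt (L : Fin n → Set) {c : Fin n} (local : LocalSet E c (λ x → L x × OnGLeg E c x)) where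

    S : Fin n → Set
    S x = L x × OnGLeg E c x

    zero-unique : ∀ a b → Leg E c a → Leg E c b → TypeS0 E S c a → TypeS0 E S c b → a ≡ b
    zero-unique = proj₁ (proj₂ local)

    leg-type : ∀ a → Leg E c a →
               TypeS0 E S c a ⊎ TypeS1 E S c a ⊎ TypeS2 E S c a ⊎ TypeS3 E S c a
    leg-type = proj₁ (proj₂ (proj₂ local))

    modleg-type : ∀ a w → ModLeg E c a w → TypeM1 E S c a w ⊎ TypeM2 E S c a w ⊎ TypeM3 E S c a w
    modleg-type = proj₁ (proj₂ (proj₂ (proj₂ local)))

    zero-excludes-m1 : ∀ a → Leg E c a → TypeS0 E S c a → ∀ b w → ModLeg E c b w → ¬ TypeM1 E S c b w
    zero-excludes-m1 = proj₁ (proj₂ (proj₂ (proj₂ (proj₂ local))))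

    long-zero : ∀ a → LongLeg E c a → TypeS0 E S c a → ∀ b → LongLeg E c b → b ≢ a → TypeS2 E S c b
    long-zero = proj₁ (proj₂ (proj₂ (proj₂ (proj₂ (proj₂ local)))))

    short-zero : ∀ a → ShortLeg E c a → TypeS0 E S c a → ∀ b → LongLeg E c b →
                 TypeS2 E S c b ⊎ TypeS3 E S c b
    short-zero = proj₂ (proj₂ (proj₂ (proj₂ (proj₂ (proj₂ local)))))

    One Two : Fin n → Set
    One b = ∃[ τ ] (L τ × InSub E c b τ)
    Two b = TwoIn L (InSub E c b)

    Occupancy : Fin n → Set
    Occupancy b = (Leg E c b × TypeS0 E S c b) ⊎ (Leg E c b × One b)
                ⊎ (∃[ w ] (ModLeg E c b w × TypeM1 E S c b w)) ⊎ Two b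

    s2⇒two : ∀ {b} → TypeS2 E S c b → Two b
    s2⇒two (τ , τ′ , τ≢τ′ , τ∈b , Sτ , τ′∈b , Sτ′) = τ , τ′ , τ≢τ′ , proj₁ Sτ , proj₁ Sτ′ , τ∈b , τ′∈b

    occupancy : ∀ {b} → GLeg c b → Occupancy b
    occupancy {b} (inj₁ leg) with leg-type b leg
    ... | inj₁ s0 = inj₁ (leg , s0)
    ... | inj₂ (inj₁ (τ , τ∈b , Sτ , _)) = inj₂ (inj₁ (leg , τ , proj₁ Sτ , τ∈b))
    ... | inj₂ (inj₂ (inj₁ s2)) = inj₂ (inj₂ (inj₂ (s2⇒two s2)))
    ... | inj₂ (inj₂ (inj₂ (Sb , _))) = inj₂ (inj₁ (leg , b , proj₁ Sb , branch-root (proj₁ leg)))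
    occupancy {b} (inj₂ (w , modleg)) with modleg-type b w modleg
    ... | inj₁ m1 = inj₂ (inj₂ (inj₁ (w , modleg , m1)))
    ... | inj₂ (inj₁ (_ , τ , τ′ , τ≢τ′ , τ∈b , Sτ , _ , τ′∈b , Sτ′ , _)) =
          inj₂ (inj₂ (inj₂ (τ , τ′ , τ≢τ′ , proj₁ Sτ , proj₁ Sτ′ , τ∈b , τ′∈b)))
    ... | inj₂ (inj₂ (τ , τ′ , (τ≢τ′ , τ∈b , Sτ , τ′∈b , Sτ′) , _)) =
          inj₂ (inj₂ (inj₂ (τ , τ′ , τ≢τ′ , proj₁ Sτ , proj₁ Sτ′ , τ∈b , τ′∈b)))

    m1⇒one : ∀ {b w} → TypeM1 E S c b w → One b
    m1⇒one (τ , (τ∈b , _) , Sτ , _) = τ , proj₁ Sτ , τ∈b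

    zero⇒¬one : ∀ {b} → Leg E c b → TypeS0 E S c b → ¬ One b
    zero⇒¬one leg s0 (τ , Lτ , τ∈b) = s0 τ τ∈b (Lτ , _ , inj₁ leg , τ∈b)

    InEither : Fin n → Fin n → Fin n → Set
    InEither a b τ = InSub E c a τ ⊎ InSub E c b τ

    swap-either : ∀ {a b τ} → InEither a b τ → InEither b a τ
    swap-either = [ inj₂ , inj₁ ]′

    one-one : ∀ {a b} → a ≢ b → One a → One b → TwoIn L (InEither a b)
    one-one a≢b (τ , Lτ , τ∈a) (τ′ , Lτ′ , τ′∈b) =
      τ , τ′ , (λ { refl → a≢b (branch-unique τ∈a τ′∈b) }) , Lτ , Lτ′ , inj₁ τ∈a , inj₂ τ′∈b

    -- The only configuration of two g-legs not carrying two vertices of L: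
    -- an empty standard leg next to a standard leg with vertices of L, one of the two short.
    EmptyBeside : Fin n → Fin n → Set
    EmptyBeside a b = Leg E c a × TypeS0 E S c a × Leg E c b × One b × (ShortLeg E c a ⊎ ShortLeg E c b)

    empty-beside : ∀ {a b} → a ≢ b → Leg E c a → TypeS0 E S c a → Leg E c b → One b →
                   TwoIn L (InEither a b) ⊎ EmptyBeside a b
    empty-beside {a} {b} a≢b leg-a s0 leg-b one with Short? c a | Short? c b
    ... | no long-a | no long-b = inj₁ (TwoIn-map inj₂ (s2⇒two
          (long-zero a (leg-a , long-a) s0 b (leg-b , long-b) (a≢b ∘ sym))))
    ... | yes short-a | _ = inj₂ (leg-a , s0 , leg-b , one , inj₁ (leg-a , short-a))
    ... | no _ | yes short-b = inj₂ (leg-a , s0 , leg-b , one , inj₂ (leg-b , short-b))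

    two-glegs : ∀ {a b} → a ≢ b → GLeg c a → GLeg c b →
                TwoIn L (InEither a b) ⊎ EmptyBeside a b ⊎ EmptyBeside b a
    two-glegs {a} {b} a≢b ga gb with occupancy ga | occupancy gb
    ... | inj₂ (inj₂ (inj₂ two)) | _ = inj₁ (TwoIn-map inj₁ two)
    ... | _ | inj₂ (inj₂ (inj₂ two)) = inj₁ (TwoIn-map inj₂ two)
    ... | inj₁ (la , za) | inj₁ (lb , zb) = ⊥-elim (a≢b (zero-unique a b la lb za zb))
    ... | inj₁ (la , za) | inj₂ (inj₂ (inj₁ (w , ml , m1))) = ⊥-elim (zero-excludes-m1 a la za b w ml m1)
    ... | inj₂ (inj₂ (inj₁ (w , ml , m1))) | inj₁ (lb , zb) = ⊥-elim (zero-excludes-m1 b lb zb a w ml m1)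
    ... | inj₁ (la , za) | inj₂ (inj₁ (lb , ob)) = [ inj₁ , inj₂ ∘ inj₁ ]′ (empty-beside a≢b la za lb ob)
    ... | inj₂ (inj₁ (la , oa)) | inj₁ (lb , zb) =
          [ inj₁ ∘ TwoIn-map swap-either , inj₂ ∘ inj₂ ]′ (empty-beside (a≢b ∘ sym) lb zb la oa)
    ... | inj₂ (inj₁ (_ , oa)) | inj₂ (inj₁ (_ , ob)) = inj₁ (one-one a≢b oa ob)
    ... | inj₂ (inj₁ (_ , oa)) | inj₂ (inj₂ (inj₁ (_ , _ , m1))) = inj₁ (one-one a≢b oa (m1⇒one m1))
    ... | inj₂ (inj₂ (inj₁ (_ , _ , m1))) | inj₂ (inj₁ (_ , ob)) = inj₁ (one-one a≢b (m1⇒one m1) ob)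
    ... | inj₂ (inj₂ (inj₁ (_ , _ , m1))) | inj₂ (inj₂ (inj₁ (_ , _ , m2))) =
          inj₁ (one-one a≢b (m1⇒one m1) (m1⇒one m2))

  LocalEverywhere : (Fin n → Set) → Set
  LocalEverywhere L = ∀ u → RegularCore E u → LocalSet E u (λ x → L x × OnGLeg E u x)

  -- At a regular core u ≠ v that is extremal with respect to v, the branches
  -- avoiding v are g-legs and together carry two vertices of L.
  module AtExtremalCore (L : Fin n → Set) (local : LocalEverywhere L)
    {v u : Fin n} (u-reg : RegularCore E u) (u≢v : u ≢ v) (extremal : Extremal v u) where
    open LocalSetAt L (local u u-reg)

    Away : Fin n → Set
    Away b = Adj E u b × ¬ InSub E u b v

    -- Cores in branches avoiding v are small, and such a branch contains at most one.
    one-small-core : ∀ {b c c′} → Away b → InSub E u b c → InSub E u b c′ →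
                     SmallCore E c → SmallCore E c′ → c ≡ c′
    one-small-core {b} {c} {c′} (ub , v∉b) c∈b c′∈b small small′ with c ≟ c′
    ... | yes c≡c′ = c≡c′
    ... | no c≢c′ with c ∈? path u c′ | c′ ∈? path u c
    ...   | yes c∈ | _ = ⊥-elim (small-core-not-between small (proj₁ u-reg) (small⇒core small′) c∈
                                   (branch-≢ c∈b ∘ sym) (c≢c′ ∘ sym))
    ...   | no _ | yes c′∈ = ⊥-elim (small-core-not-between small′ (proj₁ u-reg) (small⇒core small) c′∈
                                   (branch-≢ c′∈b ∘ sym) c≢c′)
    ...   | no c∉ | no c′∉ with fork c∈b c′∈b c∉ c′∉
    ...     | m , _ , _ , m∈b , f@(_ , _ , _ , _ , _ , h₁≢h₂ , _ , c∈h₁ , c′∈h₂) =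
              ⊥-elim (h₁≢h₂ (small-core-blocks
                (non-regular-core⇒small (fork⇒core f) (extremal b m ub v∉b m∈b))
                c∈h₁ (small⇒core small) c′∈h₂ (small⇒core small′)))

    away-gleg : ∀ {b} → Away b → GLeg u b
    away-gleg {b} away@(ub , v∉b) with any-Fin? (λ c → InSub? u b c ×-dec Core? c)
    ... | no no-core = inj₁ (ub , λ x x∈b x-core → no-core (x , x∈b , x-core))
    ... | yes (c , c∈b , c-core) = inj₂ (c , ub , c∈b , small c∈b c-core , unique)
      where
      small : ∀ {x} → InSub E u b x → Core E x → SmallCore E x
      small x∈b x-core = non-regular-core⇒small x-core (extremal b _ ub v∉b x∈b)
      unique : ∀ x → InSub E u b x → Core E x → x ≡ c
      unique x x∈b x-core = one-small-core away x∈b c∈b (small x∈b x-core) (small c∈b c-core)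

    towards-v : ∃[ t ] (Adj E u t × InSub E u t v × d u v ≡ suc (d t v))
    towards-v = first-step (u≢v ∘ sym)

    t : Fin n
    t = proj₁ towards-v

    away : ∀ {h} → Adj E u h → h ≢ t → Away h
    away uh h≢t = uh , λ v∈h → h≢t (branch-unique v∈h (proj₁ (proj₂ (proj₂ towards-v))))

    third-away : ∀ {b₁ b₂} → deg E u ≢ 3 → ∃[ b₃ ] (Away b₃ × b₃ ≢ b₁ × b₃ ≢ b₂)
    third-away {b₁} {b₂} deg≢3 with missed-neighbour (t ∷ b₁ ∷ b₂ ∷ []) (≤∧≢⇒< (proj₁ u-reg) (deg≢3 ∘ sym))
    ... | h , uh , h∉ = h , away uh (h∉ ∘ here) , h∉ ∘ there ∘ here , h∉ ∘ there ∘ there ∘ here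

    AwayIn : Fin n → Set
    AwayIn τ = ∃[ b ] (Away b × InSub E u b τ)

    from-either : ∀ {a b} → Away a → Away b → TwoIn L (InEither a b) → TwoIn L AwayIn
    from-either away-a away-b = TwoIn-map [ (λ τ∈a → _ , away-a , τ∈a) , (λ τ∈b → _ , away-b , τ∈b) ]′

    -- An empty leg beside an occupied one: u is small if it has degree 3;
    -- otherwise a third branch supplies the missing vertex of L.
    beside : ∀ {a b} → Away a → Away b → a ≢ b → EmptyBeside a b → TwoIn L AwayIn
    beside {a} {b} _ away-b a≢b (leg-a , s0 , leg-b , one , shortness) with deg E u ≟ℕ 3
    ... | yes deg≡3 = ⊥-elim (proj₂ u-reg (short-beside⇒small deg≡3 a≢b leg-a leg-b shortness))
    ... | no deg≢3 with third-away {a} {b} deg≢3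
    ... | b₃ , away-3 , b₃≢a , b₃≢b with two-glegs b₃≢b (away-gleg away-3) (inj₁ leg-b)
    ...   | inj₁ two = from-either away-3 away-b two
    ...   | inj₂ (inj₁ (leg-3 , s0-3 , _)) = ⊥-elim (b₃≢a (zero-unique _ _ leg-3 leg-a s0-3 s0))
    ...   | inj₂ (inj₂ (_ , s0-b , _)) = ⊥-elim (zero⇒¬one leg-b s0-b one)

    two-away : ∀ {b₁ b₂} → Away b₁ → Away b₂ → b₁ ≢ b₂ → TwoIn L AwayIn
    two-away away-1 away-2 b₁≢b₂ with two-glegs b₁≢b₂ (away-gleg away-1) (away-gleg away-2)
    ... | inj₁ two = from-either away-1 away-2 two
    ... | inj₂ (inj₁ eb) = beside away-1 away-2 b₁≢b₂ eb
    ... | inj₂ (inj₂ eb) = beside away-2 away-1 (b₁≢b₂ ∘ sym) eb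

    -- Of the (at least) three branches of u, at most one contains v.
    two-in-away-branches : TwoIn L AwayIn
    two-in-away-branches with core⇒three-neighbours (proj₁ u-reg)
    ... | a , b , c , ua , ub , uc , a≢b , a≢c , b≢c with a ≟ t | b ≟ t
    ...   | yes refl | _ = two-away (away ub (a≢b ∘ sym)) (away uc (a≢c ∘ sym)) b≢c
    ...   | no a≢t | yes refl = two-away (away ua a≢t) (away uc (b≢c ∘ sym)) a≢c
    ...   | no a≢t | no b≢t = two-away (away ua a≢t) (away ub b≢t) a≢b

    -- Vertices in branches of u avoiding v lie outside all g-legs of v,
    -- since the g-leg of v containing them would contain the regular core u.
    away⇒outside : ∀ {τ} → AwayIn τ → ∀ a → GLeg v a → ¬ InSub E v a τ
    away⇒outside (b , (_ , v∉b) , τ∈b) a gleg τ∈a with first-step u≢v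
    ... | _ , _ , u∈t , _ with branch-unique τ∈a (branch-transfer u∈t τ∈b v∉b)
    ... | refl = gleg-no-regular gleg u∈t u-reg

  two-outside : ∀ {L} → LocalEverywhere L → ∀ {v r} → RegularCore E r → r ≢ v →
                TwoIn L (λ τ → ∀ a → GLeg v a → ¬ InSub E v a τ)
  two-outside {L} local {v} r-reg r≢v with extremal-core r-reg r≢v
  ... | u , u-reg , u≢v , extremal =
        TwoIn-map {Q = λ τ → ∀ a → GLeg v a → ¬ InSub E v a τ} away⇒outside two-in-away-branches
    where open AtExtremalCore L local u-reg u≢v extremal

  separates : ∀ {τ x y} → d x τ ≢ d y τ → Separates E τ x y
  separates {τ} {x} {y} dist≢ = d x τ , d y τ , d⇒Dist x τ , d⇒Dist y τ , dist≢

  module AtRegularCore (L : Fin n → Set) (local : LocalEverywhere L) {v : Fin n} (v-reg : RegularCore E v) where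
    open LocalSetAt L (local v v-reg)

    Outside : Fin n → Set
    Outside τ = ∀ a → GLeg v a → ¬ InSub E v a τ

    Ball : Fin n → Set
    Ball x = x ≡ v ⊎ OnGLeg E v x

    SeparatedByTwo : Fin n → Fin n → Set
    SeparatedByTwo x y = TwoIn L (λ τ → Separates E τ x y)

    unequal-distances : ∀ {x y} → Ball x → Ball y → d x v ≢ d y v → TwoIn L Outside → SeparatedByTwo x y
    unequal-distances {x} {y} x∈ y∈ dist≢ = TwoIn-map λ {τ} outside → separates λ e →
      dist≢ (+-cancelʳ-≡ (d v τ) (d x v) (d y v) (trans (sym (via-v x∈ outside)) (trans e (via-v y∈ outside))))
      where
      via-v : ∀ {z τ} → Ball z → Outside τ → d z τ ≡ d z v + d v τ
      via-v {τ = τ} (inj₁ refl) _ = cong (_+ d v τ) (sym (d-refl v))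
      via-v (inj₂ (a , gleg , z∈a)) outside = d-through z∈a (outside a gleg)

    empty-beside-v : ∀ {a b x y} → EmptyBeside a b → InSub E v a x → InSub E v b y →
                     d v x ≡ d v y → ¬ L y → Two b
    empty-beside-v {a} {b} {x} {y} (leg-a , s0 , leg-b , (τ , Lτ , τ∈b) , shortness) x∈a y∈b e ¬Ly
      with Short? v b
    ... | yes short-b = ⊥-elim (¬Ly (subst L (trans (short-b τ τ∈b) (sym (short-b y y∈b))) Lτ))
    ... | no long-b with shortness
    ...   | inj₂ (_ , short-b) = ⊥-elim (long-b short-b)
    ...   | inj₁ short-a@(_ , on-a) with short-zero a short-a s0 b (leg-b , long-b)
    ...     | inj₁ s2 = s2⇒two s2
    ...     | inj₂ (Sb , _) = ⊥-elim (¬Ly (subst L (sym y≡b) (proj₁ Sb)))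
      where
      -- x lies on the short leg, so y lies at distance 1 from v
      y≡b : y ≡ b
      y≡b = branch-at-distance-1 y∈b (trans (sym e) (trans (cong (d v) (on-a x x∈a)) (d-adj (proj₁ leg-a))))

    different-glegs : ∀ {a b x y} → a ≢ b → GLeg v a → GLeg v b → InSub E v a x → InSub E v b y →
                      d v x ≡ d v y → ¬ L x → ¬ L y → SeparatedByTwo x y
    different-glegs {a} {b} {x} {y} a≢b ga gb x∈a y∈b e ¬Lx ¬Ly =
      TwoIn-map (separates ∘ split) two
      where
      two : TwoIn L (InEither a b)
      two with two-glegs a≢b ga gb
      ... | inj₁ two = two
      ... | inj₂ (inj₁ eb) = TwoIn-map inj₂ (empty-beside-v eb x∈a y∈b e ¬Ly)
      ... | inj₂ (inj₂ eb) = TwoIn-map inj₁ (empty-beside-v eb y∈b x∈a (sym e) ¬Lx)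
      split : ∀ {τ} → InEither a b τ → d x τ ≢ d y τ
      split (inj₁ τ∈a) = <⇒≢ (closer-in-own-branch x∈a y∈b a≢b e τ∈a)
      split (inj₂ τ∈b) = ≢-sym (<⇒≢ (closer-in-own-branch y∈b x∈a (a≢b ∘ sym) (sym e) τ∈b))

    -- (iii) Equal distances, the same g-leg: it is a modified leg and {x, y} = {ℓ^a, ℓ^b}.
    same-gleg : ∀ {a x y} → GLeg v a → InSub E v a x → InSub E v a y → x ≢ y →
                d v x ≡ d v y → ¬ L x → ¬ L y → SeparatedByTwo x y
    same-gleg (inj₁ leg) x∈a y∈a x≢y e _ _ = ⊥-elim (x≢y (leg-position-injective leg x∈a y∈a e))
    same-gleg {a} {x} {y} (inj₂ (w , modleg@(_ , _ , (deg≡3 , a₁ , a₂ , a₁≢a₂ , leg₁ , leg₂ , short₁) , _)))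
              x∈a y∈a x≢y e ¬Lx ¬Ly = result
      where
      open ModLegAnatomy (proj₁ v-reg) modleg deg≡3 a₁≢a₂ leg₁ leg₂ short₁
      pair : (x ≡ a₁ × y ≡ a₂) ⊎ (x ≡ a₂ × y ≡ a₁)
      pair = equidistant-pair x∈a y∈a x≢y e
      ends∉L : ¬ L a₁ × ¬ L a₂
      ends∉L with pair
      ... | inj₁ (x≡a₁ , y≡a₂) = subst (¬_ ∘ L) x≡a₁ ¬Lx , subst (¬_ ∘ L) y≡a₂ ¬Ly
      ... | inj₂ (x≡a₂ , y≡a₁) = subst (¬_ ∘ L) y≡a₁ ¬Ly , subst (¬_ ∘ L) x≡a₂ ¬Lx
      special∉L : ∀ {z} → Special E S v a w z → ¬ L z
      special∉L (z∈a , _ , dw , dz) Lz with next-to-core z∈a (trans (Dist⇒d dz) (cong suc (sym (Dist⇒d dw))))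
      ... | inj₁ z≡a₁ = proj₁ ends∉L (subst L z≡a₁ Lz)
      ... | inj₂ z≡a₂ = proj₂ ends∉L (subst L z≡a₂ Lz)
      -- vertices far beyond w lie on its long leg a₂, hence closer to a₂ than to a₁
      a₂-closer : ∀ {τ} → InSub E v a τ → FarPos E S v a w τ → d a₂ τ < d a₁ τ
      a₂-closer τ∈a (_ , _ , dw , dτ , le) =
        closer-in-own-branch (branch-root (proj₁ leg₂)) (branch-root (proj₁ leg₁)) (a₁≢a₂ ∘ sym)
          (trans (d-adj (proj₁ leg₂)) (sym (d-adj (proj₁ leg₁))))
          (far-from-core τ∈a (subst₂ (λ i j → suc (suc i) ≤ j) (sym (Dist⇒d dw)) (sym (Dist⇒d dτ)) le))
      separates-pair : ∀ {τ} → InSub E v a τ → FarPos E S v a w τ → Separates E τ x y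
      separates-pair {τ} τ∈a far = separates (by-pair pair)
        where
        by-pair : (x ≡ a₁ × y ≡ a₂) ⊎ (x ≡ a₂ × y ≡ a₁) → d x τ ≢ d y τ
        by-pair (inj₁ (x≡a₁ , y≡a₂)) =
          subst₂ (λ p q → d p τ ≢ d q τ) (sym x≡a₁) (sym y≡a₂) (≢-sym (<⇒≢ (a₂-closer τ∈a far)))
        by-pair (inj₂ (x≡a₂ , y≡a₁)) =
          subst₂ (λ p q → d p τ ≢ d q τ) (sym x≡a₂) (sym y≡a₁) (<⇒≢ (a₂-closer τ∈a far))
      result : SeparatedByTwo x y
      result with modleg-type a w modleg
      ... | inj₁ (z , special , Sz , _) = ⊥-elim (special∉L special (proj₁ Sz))
      ... | inj₂ (inj₂ (_ , _ , _ , z , special , Sz)) = ⊥-elim (special∉L special (proj₁ Sz))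
      ... | inj₂ (inj₁ (_ , τ , τ′ , τ≢τ′ , τ∈a , Sτ , far , τ′∈a , Sτ′ , far′)) =
            τ , τ′ , τ≢τ′ , proj₁ Sτ , proj₁ Sτ′ , separates-pair τ∈a far , separates-pair τ′∈a far′

    equal-distances : ∀ {x y} → x ≢ y → ¬ L x → ¬ L y → Ball x → Ball y → d x v ≡ d y v → SeparatedByTwo x y
    equal-distances x≢y _ _ (inj₁ refl) (inj₁ refl) _ = ⊥-elim (x≢y refl)
    equal-distances x≢y _ _ (inj₁ refl) (inj₂ _) e = ⊥-elim (x≢y (sym (d≡0⇒≡ (trans (sym e) (d-refl v)))))
    equal-distances x≢y _ _ (inj₂ _) (inj₁ refl) e = ⊥-elim (x≢y (d≡0⇒≡ (trans e (d-refl v))))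
    equal-distances {x} {y} x≢y ¬Lx ¬Ly (inj₂ (a , ga , x∈a)) (inj₂ (b , gb , y∈b)) e with a ≟ b
    ... | no a≢b = different-glegs a≢b ga gb x∈a y∈b e′ ¬Lx ¬Ly
      where
      e′ : d v x ≡ d v y
      e′ = trans (d-sym v x) (trans e (d-sym y v))
    ... | yes refl = same-gleg ga x∈a y∈b x≢y e′ ¬Lx ¬Ly
      where
      e′ : d v x ≡ d v y
      e′ = trans (d-sym v x) (trans e (d-sym y v))

    separated : (∃[ r ] (RegularCore E r × r ≢ v)) →
                ∀ {x y} → x ≢ y → ¬ L x → ¬ L y → Ball x → Ball y → SeparatedByTwo x y
    separated (r , r-reg , r≢v) {x} {y} x≢y ¬Lx ¬Ly x∈ y∈ with d x v ≟ℕ d y v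
    ... | no d≢ = unequal-distances x∈ y∈ d≢ (two-outside local r-reg r≢v)
    ... | yes e = equal-distances x≢y ¬Lx ¬Ly x∈ y∈ e

lemma5 : (n : ℕ) (E : Fin n → Fin n → Bool) → IsTree E
  → ∃[ v₁ ] ∃[ v₂ ] (v₁ ≢ v₂ × RegularCore E v₁ × RegularCore E v₂)
  → (L : Fin n → Set)
  → (∀ v → RegularCore E v → LocalSet E v (λ x → L x × OnGLeg E v x))
  → ∀ v → RegularCore E v
  → ∀ x y → x ≢ y → ¬ L x → ¬ L y
  → (x ≡ v ⊎ OnGLeg E v x) → (y ≡ v ⊎ OnGLeg E v y)
  → ∃[ τ₁ ] ∃[ τ₂ ] (τ₁ ≢ τ₂ × L τ₁ × L τ₂ × Separates E τ₁ x y × Separates E τ₂ x y)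
lemma5 n E tree (v₁ , v₂ , v₁≢v₂ , reg₁ , reg₂) L local v v-reg x y x≢y ¬Lx ¬Ly x∈ y∈ =
  separated another-regular-core x≢y ¬Lx ¬Ly x∈ y∈
  where
  open Tree E tree
  open AtRegularCore L local v-reg
  another-regular-core : ∃[ r ] (RegularCore E r × r ≢ v)
  another-regular-core with v₁ ≟ v
  ... | yes refl   = v₂ , reg₂ , v₁≢v₂ ∘ sym
  ... | no  v₁≢v   = v₁ , reg₁ , v₁≢v
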